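{- For every $k\in\mathbb{N}$ and every $X\in\{\mathbb{R}^{k+1},\mathcal{L}^k\}$, the entropy of $X$ is $e(X)=\lim_{n\to\infty}\frac{\log_2|X_n|}{\binom{n}{2}}=0$.
   Context: Two distinct letters $\mathtt a,\mathtt b$ alternate in a word $w$ if deleting all other letters yields one of $(\mathtt{ab})^n$, $(\mathtt{ab})^n\mathtt a$, $(\mathtt{ba})^n$, $(\mathtt{ba})^n\mathtt b$ for some $n\ge1$. A graph $G=(V,E)$ is represented by $w$ if the set of letters of $w$ is $V$ and distinct $\mathtt a,\mathtt b\in V$ alternate in $w$ iff $\{\mathtt a,\mathtt b\}\in E$. A word is $k$-uniform if each of its letters occurs exactly $k$ times; $\mathbb{R}^k$ is the class of graphs represented by some $k$-uniform word. A marking sequence for $w$ is an enumeration $(\mathtt a_1,\dots,\mathtt a_n)$ of the distinct letters of $w$; at stage $i$ all occurrences of $\mathtt a_1,\dots,\mathtt a_i$ are marked, and a marked block is a maximal factor of consecutive marked positions; $w$ is $k$-local if some marking sequence gives at most $k$ marked blocks at every stage. $\mathcal L^k$ is the class of graphs represented by some $k$-local word. For a class of graphs $X$ and $n\in\mathbb{N}$, $X_n=\{G\in X\mid V(G)=\{1,\dots,n\}\}$ (labelled graphs on node set $[n]$). -}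

module Defs where

open import Data.Nat using (ℕ; zero; suc; _+_; _*_; _^_; _≤_; _<_; _<ᵇ_)
open import Data.Nat.Combinatorics using (_C_)
open import Data.Bool using (Bool; true; false; _∧_; not)
open import Data.Fin using (Fin; toℕ; _≟_)
open import Data.Fin.Permutation using (Permutation′; _⟨$⟩ˡ_)
open import Data.List using (List; []; _∷_; _++_; length; filter; map)
open import Data.List.Membership.Propositional using (_∈_)
open import Data.Product using (Σ; ∃; ∃-syntax; _×_; _,_)
open import Data.Sum using (_⊎_)
open import Relation.Binary.PropositionalEquality using (_≡_; _≢_)
open import Relation.Nullary using (¬_; yes; no)
open import Relation.Nullary.Decidable using (⌊_⌋; _⊎-dec_)
open import Function.Bundles using (_⇔_)

record Graph (n : ℕ) : Set where
  field
    adj   : Fin n → Fin n → Bool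
    irrefl : ∀ x → adj x x ≡ false
    sym   : ∀ x y → adj x y ≡ adj y x
open Graph public

_≈G_ : ∀ {n} → Graph n → Graph n → Set
G ≈G H = ∀ x y → adj G x y ≡ adj H x y

Word : ℕ → Set
Word n = List (Fin n)

rep : ∀ {A : Set} → ℕ → List A → List A
rep zero    u = []
rep (suc m) u = u ++ rep m u

restrict : ∀ {n} → Fin n → Fin n → Word n → Word n
restrict a b = filter (λ x → (x ≟ a) ⊎-dec (x ≟ b))

Alternate : ∀ {n} → Word n → Fin n → Fin n → Set
Alternate w a b = ∃[ m ] (1 ≤ m ×
  ( restrict a b w ≡ rep m (a ∷ b ∷ [])
  ⊎ restrict a b w ≡ rep m (a ∷ b ∷ []) ++ (a ∷ [])
  ⊎ restrict a b w ≡ rep m (b ∷ a ∷ [])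
  ⊎ restrict a b w ≡ rep m (b ∷ a ∷ []) ++ (b ∷ [])))

Represents : ∀ {n} → Word n → Graph n → Set
Represents {n} w G =
  (∀ (x : Fin n) → x ∈ w) ×
  (∀ (a b : Fin n) → a ≢ b → (Alternate w a b ⇔ (adj G a b ≡ true)))

occ : ∀ {n} → Fin n → Word n → ℕ
occ x w = length (filter (λ y → y ≟ x) w)

Uniform : ∀ {n} → ℕ → Word n → Set
Uniform {n} k w = ∀ (x : Fin n) → occ x w ≡ k

-- number of marked blocks (maximal runs of `true`) in a Boolean sequence;
-- the flag records whether the previous position was marked.
blocksFrom : Bool → List Bool → ℕ
blocksFrom prev []           = 0
blocksFrom prev (false ∷ bs) = blocksFrom false bs
blocksFrom true  (true ∷ bs) = blocksFrom true bs
blocksFrom false (true ∷ bs) = suc (blocksFrom true bs)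

blocks : List Bool → ℕ
blocks = blocksFrom false

-- A marking sequence (a_1,...,a_n) of the letters [n] is given by a
-- permutation σ with σ(j) = a_{j+1}; at stage i the letter x is marked
-- iff x ∈ {a_1,...,a_i}, i.e. σ⁻¹(x) < i.
markedAt : ∀ {n} → Permutation′ n → ℕ → Fin n → Bool
markedAt σ i x = toℕ (σ ⟨$⟩ˡ x) <ᵇ i

Local : ∀ {n} → ℕ → Word n → Set
Local {n} k w = ∃[ σ ] ∀ (i : ℕ) → 1 ≤ i → i ≤ n →
  blocks (map (markedAt σ i) w) ≤ k

GraphClass : Set₁
GraphClass = (n : ℕ) → Graph n → Set

R : ℕ → GraphClass
R k n G = ∃[ w ] (Uniform k w × Represents w G)

L : ℕ → GraphClass
L k n G = ∃[ w ] (Local k w × Represents w G)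

-- |X_n| ≤ B : some list of at most B graphs covers X_n (up to equality of graphs)
CardLe : ∀ {n} → (Graph n → Set) → ℕ → Set
CardLe {n} P B = ∃[ Gs ] (length Gs ≤ B ×
  (∀ G → P G → ∃[ H ] (H ∈ Gs × G ≈G H)))

-- e(X) = lim_{n→∞} log₂|X_n| / C(n,2) = 0, unfolded over ℕ:
-- for every m ≥ 1 there is N such that for all n ≥ N,
--   X_n is nonempty (so log₂|X_n| ≥ 0 is defined) and
--   log₂|X_n| ≤ C(n,2)/m, i.e. |X_n|^m ≤ 2^C(n,2)
-- (this is "there is a list of graphs covering X_n whose length ℓ has ℓ^m ≤ 2^C(n,2)").
EntropyZero : GraphClass → Set
EntropyZero X = ∀ (m : ℕ) → 1 ≤ m → ∃[ N ] ∀ (n : ℕ) → N ≤ n →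
  (∃[ G ] X n G) ×
  (∃[ B ] (B ^ m ≤ 2 ^ (n C 2) × CardLe (X n) B))

{-# OPTIONS --safe #-}
-- Every graph in either class has its edges represented by a word of length at most cn, and such
-- a word determines the graph, so |X_n| ≤ (n+1)^{cn}, which bounds the number of these words;
-- since exponentials dominate polynomials, (n+1)^{cnm} ≤ 2^{C(n,2)} for large n.
-- A graph in ℝ^{k+1} is represented by its own word of length (k+1)n. For a k-local word w,
-- let a alternate with some b and let a be marked in the step from stage j to stage j + 1.
-- In the restriction of w to {a, b} no two a's are adjacent, so inside each block of stage j + 1
-- any two occurrences of a are separated by a block of stage j; deleting letters creates no
-- blocks, hence a occurs at most (blocks at stage j) + (blocks at stage j + 1) ≤ 2k times in w.
-- Deleting all letters occurring more than 2k times thus keeps every alternation and leaves a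
-- word of length ≤ 2kn.
module Submission where

open import Defs hiding (sym)
open import Data.Bool using (Bool; true; false; not)
open import Data.Bool.Properties using (T-≡)
open import Data.Fin as Fin using (Fin; toℕ; _≟_; punchIn)
open import Data.Fin.Permutation using (Permutation′; _⟨$⟩ˡ_; _⟨$⟩ʳ_; inverseʳ)
import Data.Fin.Permutation as Perm
open import Data.Fin.Properties using (punchInᵢ≢i; toℕ-injective; toℕ<n)
open import Data.List
  using (List; []; _∷_; [_]; _++_; length; filter; map; tabulate; allFin; cartesianProductWith)
open import Data.List.Membership.Propositional using (_∈_)
open import Data.List.Membership.Propositional.Properties
  using (∈-filter⁺; ∈-filter⁻; ∈-++⁺ˡ; ∈-map⁺; ∈-allFin; ∈-cartesianProductWith⁺)
open import Data.List.Properties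
  using (≡-dec; ++-identityʳ; length-++; length-map; length-tabulate; map-∘; map-cong; map-tabulate;
         filter-++; filter-accept; filter-reject; filter-none)
open import Data.List.Relation.Binary.Sublist.Propositional using (_⊆_; []; _∷_; _∷ʳ_)
import Data.List.Relation.Binary.Sublist.Propositional.Properties as Sublist
open import Data.List.Relation.Unary.All as All using (All; []; _∷_)
open import Data.List.Relation.Unary.All.Properties using (all-filter)
open import Data.List.Relation.Unary.AllPairs using ([]; _∷_)
open import Data.List.Relation.Unary.Any using (here; there)
open import Data.List.Relation.Unary.Linked as Linked using (Linked; []; [-]; _∷_)
import Data.List.Relation.Unary.Linked.Properties as Linked
open import Data.List.Relation.Unary.Unique.Propositional using (Unique)
import Data.List.Relation.Unary.Unique.Propositional.Properties as Unique
open import Data.Nat using (ℕ; zero; suc; _+_; _*_; _^_; _≤_; _<ᵇ_; _≤?_; z≤n; s≤s; NonZero)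
open import Data.Nat.Combinatorics using (_C_; nC1≡n; nCk+nC[k+1]≡[n+1]C[k+1])
open import Data.Nat.Properties hiding (_≟_)
open import Data.Nat.Tactic.RingSolver using (solve-∀)
open import Algebra.Properties.CommutativeMonoid.Sum +-0-commutativeMonoid
  using (sum; ∑-distrib-+; sum-remove; sum-cong-≗; sum-replicate-zero)
open import Data.Product using (∃-syntax; _×_; _,_; proj₁; proj₂)
open import Data.Sum using (_⊎_; inj₁; inj₂)
import Data.Sum as Sum
open import Function using (id; _∘_; _⇔_; mk⇔; Equivalence)
open import Relation.Binary.Definitions using (DecidableEquality)
open import Relation.Binary.PropositionalEquality
  using (_≡_; _≢_; refl; sym; trans; cong; cong₂; subst; ≢-sym; module ≡-Reasoning)
open import Relation.Nullary using (¬_; Dec; yes; no; does; proof; contradiction; ¬?)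
open import Relation.Nullary.Decidable using (_×-dec_; _⊎-dec_; map′; dec-true; dec-false; does-⇔)
import Relation.Nullary.Reflects as Reflects
open import Relation.Unary using (Decidable)

private variable
  A : Set
  n : ℕ

filter-filter : {P Q : A → Set} (P? : Decidable P) (Q? : Decidable Q) →
                (∀ {x} → Q x → P x) → ∀ xs → filter Q? (filter P? xs) ≡ filter Q? xs
filter-filter P? Q? Q⇒P []       = refl
filter-filter P? Q? Q⇒P (x ∷ xs) with P? x
... | yes _ with Q? x
...   | yes _ = cong (x ∷_) (filter-filter P? Q? Q⇒P xs)
...   | no _  = filter-filter P? Q? Q⇒P xs
filter-filter P? Q? Q⇒P (x ∷ xs) | no ¬px with Q? x
...   | yes qx = contradiction (Q⇒P qx) ¬px
...   | no _   = filter-filter P? Q? Q⇒P xs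

filter-rep : {P : A → Set} (P? : Decidable P) → ∀ m u → filter P? (rep m u) ≡ rep m (filter P? u)
filter-rep P? zero    u = refl
filter-rep P? (suc m) u = trans (filter-++ P? u (rep m u)) (cong (filter P? u ++_) (filter-rep P? m u))

length-rep : ∀ m (u : List A) → length (rep m u) ≡ m * length u
length-rep zero    u = refl
length-rep (suc m) u = trans (length-++ u) (cong (length u +_) (length-rep m u))

unique-singleton : ∀ {x : A} {l} → Unique l → All (_≡ x) l → x ∈ l → l ≡ x ∷ []
unique-singleton {l = _ ∷ []}    _               (refl ∷ [])       _ = refl
unique-singleton {l = _ ∷ _ ∷ _} ((y≢z ∷ _) ∷ _) (refl ∷ refl ∷ _) _ = contradiction refl y≢z

unique-pair : ∀ {a b : A} {l} → a ≢ b → Unique l → All (λ y → y ≡ a ⊎ y ≡ b) l → a ∈ l → b ∈ l →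
              l ≡ a ∷ b ∷ [] ⊎ l ≡ b ∷ a ∷ []
unique-pair a≢b _ _ (here refl) (here refl) = contradiction refl a≢b
unique-pair {l = _ ∷ _ ∷ []} a≢b ((y≢z ∷ []) ∷ _) (p ∷ q ∷ []) _ _ with p | q
... | inj₁ refl | inj₂ refl = inj₁ refl
... | inj₂ refl | inj₁ refl = inj₂ refl
... | inj₁ refl | inj₁ refl = contradiction refl y≢z
... | inj₂ refl | inj₂ refl = contradiction refl y≢z
unique-pair {l = _ ∷ _ ∷ _ ∷ _} a≢b ((y≢z ∷ y≢w ∷ _) ∷ (z≢w ∷ _) ∷ _) (p ∷ q ∷ r ∷ _) _ _ with p | q | r
... | inj₁ refl | inj₁ refl | _         = contradiction refl y≢z
... | inj₂ refl | inj₂ refl | _         = contradiction refl y≢z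
... | inj₁ refl | inj₂ refl | inj₁ refl = contradiction refl y≢w
... | inj₂ refl | inj₁ refl | inj₂ refl = contradiction refl y≢w
... | inj₁ refl | inj₂ refl | inj₂ refl = contradiction refl z≢w
... | inj₂ refl | inj₁ refl | inj₁ refl = contradiction refl z≢w

wordsUpTo : List A → ℕ → List (List A)
wordsUpTo xs zero    = [] ∷ []
wordsUpTo xs (suc L) = [] ∷ cartesianProductWith _∷_ xs (wordsUpTo xs L)

length-cartesianProductWith : ∀ {B C : Set} (f : A → B → C) xs ys →
  length (cartesianProductWith f xs ys) ≡ length xs * length ys
length-cartesianProductWith f []       ys = refl
length-cartesianProductWith f (x ∷ xs) ys = trans (length-++ (map (f x) ys))
  (cong₂ _+_ (length-map (f x) ys) (length-cartesianProductWith f xs ys))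

length-wordsUpTo : ∀ (xs : List A) L → length (wordsUpTo xs L) ≤ suc (length xs) ^ L
length-wordsUpTo xs zero    = ≤-refl
length-wordsUpTo xs (suc L) = begin
  suc (length (cartesianProductWith _∷_ xs (wordsUpTo xs L)))
    ≡⟨ cong suc (length-cartesianProductWith _∷_ xs (wordsUpTo xs L)) ⟩
  suc (ℓ * length (wordsUpTo xs L))  ≤⟨ s≤s (*-monoʳ-≤ ℓ (length-wordsUpTo xs L)) ⟩
  1 + ℓ * suc ℓ ^ L                   ≤⟨ +-monoˡ-≤ (ℓ * suc ℓ ^ L) (m^n>0 (suc ℓ) L) ⟩
  suc ℓ ^ suc L                       ∎
  where
  open ≤-Reasoning
  ℓ = length xs

∈-wordsUpTo : ∀ {xs : List A} → (∀ x → x ∈ xs) → ∀ v {L} → length v ≤ L → v ∈ wordsUpTo xs L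
∈-wordsUpTo complete []      {zero}  _         = here refl
∈-wordsUpTo complete []      {suc L} _         = here refl
∈-wordsUpTo complete (x ∷ v) {suc L} (s≤s v≤L) =
  there (∈-cartesianProductWith⁺ _∷_ (complete x) (∈-wordsUpTo complete v v≤L))

occ-++ : ∀ (x : Fin n) u v → occ x (u ++ v) ≡ occ x u + occ x v
occ-++ x u v = trans (cong length (filter-++ (_≟ x) u v)) (length-++ (filter (_≟ x) u))

occ-rep : ∀ (x : Fin n) m u → occ x (rep m u) ≡ m * occ x u
occ-rep x m u = trans (cong length (filter-rep (_≟ x) m u)) (length-rep m _)

module _ {P : Fin n → Set} (P? : Decidable P) where

  occ-filter-accept : ∀ {x} → P x → ∀ w → occ x (filter P? w) ≡ occ x w
  occ-filter-accept px w = cong length (filter-filter P? (_≟ _) (λ { refl → px }) w)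

  occ-filter-reject : ∀ {x} → ¬ P x → ∀ w → occ x (filter P? w) ≡ 0
  occ-filter-reject ¬px w =
    cong length (filter-none (_≟ _) (All.map (λ { py refl → ¬px py }) (all-filter P? w)))

  restrict-filter : ∀ {a b} → P a → P b → ∀ w → restrict a b (filter P? w) ≡ restrict a b w
  restrict-filter pa pb = filter-filter P? _ λ { (inj₁ refl) → pa ; (inj₂ refl) → pb }

sum-occ-[_] : ∀ {n} (y : Fin (suc n)) → sum (λ x → occ x [ y ]) ≡ 1
sum-occ-[_] {n} y = begin
  sum (λ x → occ x [ y ])                            ≡⟨ sum-remove {i = y} (λ x → occ x [ y ]) ⟩
  occ y [ y ] + sum (λ k → occ (punchIn y k) [ y ])  ≡⟨ cong₂ _+_ occ-y (sum-cong-≗ occ-punchIn) ⟩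
  1 + sum {n} (λ _ → 0)                              ≡⟨ cong (1 +_) (sum-replicate-zero n) ⟩
  1                                                  ∎
  where
  open ≡-Reasoning
  occ-y : occ y [ y ] ≡ 1
  occ-y = cong length (filter-accept (_≟ y) refl)
  occ-punchIn : ∀ k → occ (punchIn y k) [ y ] ≡ 0
  occ-punchIn k = cong length (filter-reject (_≟ punchIn y k) (punchInᵢ≢i y k ∘ sym))

length≡∑occ : (w : Word n) → length w ≡ sum (λ x → occ x w)
length≡∑occ {n}     []      = sym (sum-replicate-zero n)
length≡∑occ {suc n} (y ∷ w) = sym (begin
  sum (λ x → occ x (y ∷ w))                     ≡⟨ sum-cong-≗ (λ x → occ-++ x [ y ] w) ⟩
  sum (λ x → occ x [ y ] + occ x w)             ≡⟨ ∑-distrib-+ (λ x → occ x [ y ]) (λ x → occ x w) ⟩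
  sum (λ x → occ x [ y ]) + sum (λ x → occ x w) ≡⟨ cong₂ _+_ sum-occ-[ y ] (sym (length≡∑occ w)) ⟩
  suc (length w)                                ∎)
  where open ≡-Reasoning

sum-≤ : ∀ {c} (f : Fin n → ℕ) → (∀ i → f i ≤ c) → sum f ≤ n * c
sum-≤ {zero}  f f≤c = z≤n
sum-≤ {suc n} f f≤c = +-mono-≤ (f≤c Fin.zero) (sum-≤ (f ∘ Fin.suc) (f≤c ∘ Fin.suc))

length≤ : ∀ {c} (w : Word n) → (∀ x → occ x w ≤ c) → length w ≤ n * c
length≤ w occ≤c = subst (_≤ _) (sym (length≡∑occ w)) (sum-≤ _ occ≤c)

-- Alternate w a b unfolds to ∃[ m ] AlternatingWord a b m (restrict a b w).
AlternatingWord : A → A → ℕ → List A → Set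
AlternatingWord a b m r = 1 ≤ m ×
  ( r ≡ rep m (a ∷ b ∷ [])
  ⊎ r ≡ rep m (a ∷ b ∷ []) ++ (a ∷ [])
  ⊎ r ≡ rep m (b ∷ a ∷ [])
  ⊎ r ≡ rep m (b ∷ a ∷ []) ++ (b ∷ []))

alternatingWord? : DecidableEquality A → ∀ a b m r → Dec (AlternatingWord a b m r)
alternatingWord? _≟ₐ_ a b m r =
  1 ≤? m ×-dec (r ≟ₗ _ ⊎-dec r ≟ₗ _ ⊎-dec r ≟ₗ _ ⊎-dec r ≟ₗ _)
  where _≟ₗ_ = ≡-dec _≟ₐ_

module _ {x y : A} where

  m≤length[rep-m-xy++s] : ∀ m s → m ≤ length (rep m (x ∷ y ∷ []) ++ s)
  m≤length[rep-m-xy++s] zero    s = z≤n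
  m≤length[rep-m-xy++s] (suc m) s = s≤s (m≤n⇒m≤1+n (m≤length[rep-m-xy++s] m s))

  m≤length[rep-m-xy] : ∀ m → m ≤ length (rep m (x ∷ y ∷ []))
  m≤length[rep-m-xy] m =
    subst (λ r → m ≤ length r) (++-identityʳ (rep m (x ∷ y ∷ []))) (m≤length[rep-m-xy++s] m [])

  linked-rep++ : x ≢ y → ∀ m {s} → Linked _≢_ (y ∷ s) → Linked _≢_ (rep m (x ∷ y ∷ []) ++ s)
  linked-rep++ x≢y zero          ys = Linked.tail ys
  linked-rep++ x≢y (suc zero)    ys = x≢y ∷ ys
  linked-rep++ x≢y (suc (suc m)) ys = x≢y ∷ ≢-sym x≢y ∷ linked-rep++ x≢y (suc m) ys

  linked-rep : x ≢ y → ∀ m → Linked _≢_ (rep m (x ∷ y ∷ []))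
  linked-rep x≢y m =
    subst (Linked _≢_) (++-identityʳ (rep m (x ∷ y ∷ []))) (linked-rep++ x≢y m [-])

module _ {a b : A} {m : ℕ} {r : List A} where

  alternatingWord⇒m≤length : AlternatingWord a b m r → m ≤ length r
  alternatingWord⇒m≤length (_ , inj₁ refl)               = m≤length[rep-m-xy] m
  alternatingWord⇒m≤length (_ , inj₂ (inj₁ refl))        = m≤length[rep-m-xy++s] m _
  alternatingWord⇒m≤length (_ , inj₂ (inj₂ (inj₁ refl))) = m≤length[rep-m-xy] m
  alternatingWord⇒m≤length (_ , inj₂ (inj₂ (inj₂ refl))) = m≤length[rep-m-xy++s] m _

  alternatingWord⇒linked : a ≢ b → AlternatingWord a b m r → Linked _≢_ r
  alternatingWord⇒linked a≢b (_ , inj₁ refl)               = linked-rep a≢b m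
  alternatingWord⇒linked a≢b (_ , inj₂ (inj₁ refl))        = linked-rep++ a≢b m (≢-sym a≢b ∷ [-])
  alternatingWord⇒linked a≢b (_ , inj₂ (inj₂ (inj₁ refl))) = linked-rep (≢-sym a≢b) m
  alternatingWord⇒linked a≢b (_ , inj₂ (inj₂ (inj₂ refl))) = linked-rep++ (≢-sym a≢b) m (a≢b ∷ [-])

  alternatingWord⇒∈ : AlternatingWord a b m r → a ∈ r × b ∈ r
  alternatingWord⇒∈ (s≤s _ , inj₁ refl)               = here refl , there (here refl)
  alternatingWord⇒∈ (s≤s _ , inj₂ (inj₁ refl))        = here refl , there (here refl)
  alternatingWord⇒∈ (s≤s _ , inj₂ (inj₂ (inj₁ refl))) = there (here refl) , here refl
  alternatingWord⇒∈ (s≤s _ , inj₂ (inj₂ (inj₂ refl))) = there (here refl) , here refl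

alternate? : (w : Word n) → ∀ a b → Dec (Alternate w a b)
alternate? w a b = map′ (λ (m , _ , alt) → m , alt)
                        (λ (m , alt) → m , s≤s (alternatingWord⇒m≤length alt) , alt)
                        (anyUpTo? (λ m → alternatingWord? _≟_ a b m r) (suc (length r)))
  where r = restrict a b w

alternate-transport : ∀ {w w′ : Word n} {a b} → restrict a b w ≡ restrict a b w′ →
                      Alternate w a b → Alternate w′ a b
alternate-transport {a = a} {b} = subst (λ r → ∃[ m ] AlternatingWord a b m r)

alternate⇒∈ : ∀ {w : Word n} {a b} → Alternate w a b → a ∈ w × b ∈ w
alternate⇒∈ {a = a} {b} (_ , alt) =
  let a∈r , b∈r = alternatingWord⇒∈ alt in
  proj₁ (∈-filter⁻ P? a∈r) , proj₁ (∈-filter⁻ P? b∈r)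
  where P? = λ x → (x ≟ a) ⊎-dec (x ≟ b)

-- Counting graphs by the words representing them

-- The edge half of Represents: the shortened words built for 𝓛^k need not contain every letter.
RepresentsEdges : Word n → Graph n → Set
RepresentsEdges {n} w G = ∀ (a b : Fin n) → a ≢ b → (Alternate w a b ⇔ (adj G a b ≡ true))

-- Both orders are tested so that the decoded graph is symmetric without proving Alternate symmetric.
Edge : Word n → Fin n → Fin n → Set
Edge w x y = x ≢ y × (Alternate w x y ⊎ Alternate w y x)

edge? : (w : Word n) → ∀ x y → Dec (Edge w x y)
edge? w x y = ¬? (x ≟ y) ×-dec (alternate? w x y ⊎-dec alternate? w y x)

edge-sym : ∀ {w : Word n} {x y} → Edge w x y ⇔ Edge w y x
edge-sym {w = w} = mk⇔ swap swap
  where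
  swap : ∀ {x y} → Edge w x y → Edge w y x
  swap (x≢y , alt) = ≢-sym x≢y , Sum.swap alt

graphOf : Word n → Graph n
graphOf w = record
  { adj    = λ x y → does (edge? w x y)
  ; irrefl = λ x → dec-false (edge? w x x) (λ (x≢x , _) → x≢x refl)
  ; sym    = λ x y → does-⇔ (edge-sym {w = w}) (edge? w x y) (edge? w y x)
  }

edge⇔adj : ∀ {w : Word n} {G} → RepresentsEdges w G → ∀ x y → Edge w x y ⇔ (adj G x y ≡ true)
edge⇔adj {w = w} {G} rep x y = mk⇔ to from
  where
  to : Edge w x y → adj G x y ≡ true
  to (x≢y , inj₁ alt) = Equivalence.to (rep x y x≢y) alt
  to (x≢y , inj₂ alt) = trans (Graph.sym G x y) (Equivalence.to (rep y x (≢-sym x≢y)) alt)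
  from : adj G x y ≡ true → Edge w x y
  from e = x≢y , inj₁ (Equivalence.from (rep x y x≢y) e)
    where
    x≢y : x ≢ y
    x≢y refl with () ← trans (sym (irrefl G x)) e

≈G-graphOf : ∀ {w : Word n} {G} → RepresentsEdges w G → G ≈G graphOf w
≈G-graphOf {w = w} {G} rep x y =
  Reflects.det (Reflects.fromEquivalence (from e ∘ to T-≡) (from T-≡ ∘ to e)) (proof (edge? w x y))
  where
  open Equivalence
  e = edge⇔adj {w = w} {G} rep x y

cardLe-shortWords : ∀ {P : Graph n → Set} L →
  (∀ G → P G → ∃[ w ] (length w ≤ L × RepresentsEdges w G)) → CardLe P (suc n ^ L)
cardLe-shortWords {n} {P} L short = map graphOf words , few , covers
  where
  words = wordsUpTo (allFin n) L
  few : length (map graphOf words) ≤ suc n ^ L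
  few = begin
    length (map graphOf words)    ≡⟨ length-map graphOf words ⟩
    length words                  ≤⟨ length-wordsUpTo (allFin n) L ⟩
    suc (length (allFin n)) ^ L   ≡⟨ cong (λ ℓ → suc ℓ ^ L) (length-tabulate id) ⟩
    suc n ^ L                     ∎
    where open ≤-Reasoning
  covers : ∀ G → P G → ∃[ H ] (H ∈ map graphOf words × G ≈G H)
  covers G pG =
    let w , w≤L , rep = short G pG in
    graphOf w , ∈-map⁺ graphOf (∈-wordsUpTo {xs = allFin n} ∈-allFin w w≤L) , ≈G-graphOf {w = w} {G} rep

-- Marked blocks

blocksFrom-true≤false : ∀ bs → blocksFrom true bs ≤ blocksFrom false bs
blocksFrom-true≤false []           = z≤n
blocksFrom-true≤false (false ∷ bs) = ≤-refl
blocksFrom-true≤false (true ∷ bs)  = n≤1+n _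

blocksFrom-false≤1+true : ∀ bs → blocksFrom false bs ≤ suc (blocksFrom true bs)
blocksFrom-false≤1+true []           = z≤n
blocksFrom-false≤1+true (false ∷ bs) = n≤1+n _
blocksFrom-false≤1+true (true ∷ bs)  = ≤-refl

blocksFrom-∷ : ∀ prev c bs → blocksFrom prev bs ≤ blocksFrom prev (c ∷ bs)
blocksFrom-∷ false false bs = ≤-refl
blocksFrom-∷ true  false bs = blocksFrom-true≤false bs
blocksFrom-∷ false true  bs = blocksFrom-false≤1+true bs
blocksFrom-∷ true  true  bs = ≤-refl

blocksFrom-⊆ : ∀ {bs cs} → bs ⊆ cs → ∀ prev → blocksFrom prev bs ≤ blocksFrom prev cs
blocksFrom-⊆ []                          prev  = z≤n
blocksFrom-⊆ (c ∷ʳ bs⊆cs)                prev  = ≤-trans (blocksFrom-⊆ bs⊆cs prev) (blocksFrom-∷ prev c _)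
blocksFrom-⊆ (_∷_ {false} refl bs⊆cs)    prev  = blocksFrom-⊆ bs⊆cs false
blocksFrom-⊆ (_∷_ {true}  refl bs⊆cs)    false = s≤s (blocksFrom-⊆ bs⊆cs true)
blocksFrom-⊆ (_∷_ {true}  refl bs⊆cs)    true  = blocksFrom-⊆ bs⊆cs true

blocksFrom-allFalse : ∀ prev (xs : List A) → blocksFrom prev (map (λ _ → false) xs) ≡ 0
blocksFrom-allFalse prev []       = refl
blocksFrom-allFalse prev (x ∷ xs) = blocksFrom-allFalse false xs

-- The status of a position in the step from stage j to stage j + 1: `fresh` positions carry the
-- letter marked in this step.
data Mark : Set where
  unmarked marked fresh : Mark

wasMarked : Mark → Bool
wasMarked marked = true
wasMarked _      = false

isMarked : Mark → Bool
isMarked unmarked = false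
isMarked _        = true

freshCount : List Mark → ℕ
freshCount []           = 0
freshCount (fresh ∷ ms) = suc (freshCount ms)
freshCount (_ ∷ ms)     = freshCount ms

NotBothFresh : Mark → Mark → Set
NotBothFresh m m′ = m ≡ fresh → m′ ≢ fresh

-- Within a block of stage j + 1 consecutive fresh positions are separated by a block of stage j,
-- which pays for the next fresh position; `credit` records such a payment not yet used.
credit : Mark → ℕ
credit marked = 1
credit _      = 0

freshCount≤blocksFrom : ∀ prev ms → Linked NotBothFresh (prev ∷ ms) →
  freshCount ms ≤ credit prev + (blocksFrom (wasMarked prev) (map wasMarked ms)
                                + blocksFrom (isMarked prev) (map isMarked ms))
freshCount≤blocksFrom prev     []              _         = z≤n
freshCount≤blocksFrom unmarked (unmarked ∷ ms) (_ ∷ l)   = freshCount≤blocksFrom unmarked ms l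
freshCount≤blocksFrom marked   (unmarked ∷ ms) (_ ∷ l)   = m≤n⇒m≤1+n (freshCount≤blocksFrom unmarked ms l)
freshCount≤blocksFrom fresh    (unmarked ∷ ms) (_ ∷ l)   = freshCount≤blocksFrom unmarked ms l
freshCount≤blocksFrom unmarked (marked ∷ ms)   (_ ∷ l)   =
  ≤-trans (freshCount≤blocksFrom marked ms l) (s≤s (+-monoʳ-≤ _ (n≤1+n _)))
freshCount≤blocksFrom marked   (marked ∷ ms)   (_ ∷ l)   = freshCount≤blocksFrom marked ms l
freshCount≤blocksFrom fresh    (marked ∷ ms)   (_ ∷ l)   = freshCount≤blocksFrom marked ms l
freshCount≤blocksFrom unmarked (fresh ∷ ms)    (_ ∷ l)   =
  ≤-trans (s≤s (freshCount≤blocksFrom fresh ms l)) (≤-reflexive (sym (+-suc _ _)))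
freshCount≤blocksFrom marked   (fresh ∷ ms)    (_ ∷ l)   = s≤s (freshCount≤blocksFrom fresh ms l)
freshCount≤blocksFrom fresh    (fresh ∷ ms)    (nbf ∷ _) = contradiction refl (nbf refl)

freshCount≤blocks : ∀ {ms} → Linked NotBothFresh ms →
  freshCount ms ≤ blocks (map wasMarked ms) + blocks (map isMarked ms)
freshCount≤blocks {[]}     _      = z≤n
freshCount≤blocks {m ∷ ms} linked = freshCount≤blocksFrom unmarked (m ∷ ms) ((λ ()) ∷ linked)

-- The mark of the letter of rank t when the letter of rank j gets marked.
markOf : ℕ → ℕ → Mark
markOf zero    zero    = fresh
markOf zero    (suc j) = marked
markOf (suc t) zero    = unmarked
markOf (suc t) (suc j) = markOf t j

wasMarked-markOf : ∀ t j → wasMarked (markOf t j) ≡ (t <ᵇ j)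
wasMarked-markOf zero    zero    = refl
wasMarked-markOf zero    (suc j) = refl
wasMarked-markOf (suc t) zero    = refl
wasMarked-markOf (suc t) (suc j) = wasMarked-markOf t j

isMarked-markOf : ∀ t j → isMarked (markOf t j) ≡ (t <ᵇ suc j)
isMarked-markOf zero    zero    = refl
isMarked-markOf zero    (suc j) = refl
isMarked-markOf (suc t) zero    = refl
isMarked-markOf (suc t) (suc j) = isMarked-markOf t j

markOf-fresh⇔ : ∀ t j → markOf t j ≡ fresh ⇔ t ≡ j
markOf-fresh⇔ t j = mk⇔ (to t j) (λ { refl → diagonal t })
  where
  to : ∀ t j → markOf t j ≡ fresh → t ≡ j
  to zero    zero    _  = refl
  to (suc t) (suc j) eq = cong suc (to t j eq)
  diagonal : ∀ t → markOf t t ≡ fresh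
  diagonal zero    = refl
  diagonal (suc t) = diagonal t

occ≡freshCount : ∀ {x : Fin n} (μ : Fin n → Mark) → (∀ y → μ y ≡ fresh ⇔ y ≡ x) →
                 ∀ w → occ x w ≡ freshCount (map μ w)
occ≡freshCount μ fresh⇔x []      = refl
occ≡freshCount {x = x} μ fresh⇔x (y ∷ w) with y ≟ x
... | yes refl rewrite Equivalence.from (fresh⇔x x) refl = cong suc (occ≡freshCount μ fresh⇔x w)
... | no y≢x with μ y in μy
...   | fresh    = contradiction (Equivalence.to (fresh⇔x y) μy) y≢x
...   | marked   = occ≡freshCount μ fresh⇔x w
...   | unmarked = occ≡freshCount μ fresh⇔x w

rank : Permutation′ n → Fin n → ℕ
rank σ x = toℕ (σ ⟨$⟩ˡ x)

rank-injective : ∀ (σ : Permutation′ n) {x y} → rank σ x ≡ rank σ y → x ≡ y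
rank-injective σ {x} {y} eq = begin
  x                    ≡⟨ sym (inverseʳ σ) ⟩
  σ ⟨$⟩ʳ (σ ⟨$⟩ˡ x)    ≡⟨ cong (σ ⟨$⟩ʳ_) (toℕ-injective eq) ⟩
  σ ⟨$⟩ʳ (σ ⟨$⟩ˡ y)    ≡⟨ inverseʳ σ ⟩
  y                    ∎
  where open ≡-Reasoning

occ≤blocks-before+after : ∀ (σ : Permutation′ n) x {r} → Linked _≢_ r →
  occ x r ≤ blocks (map (markedAt σ (rank σ x)) r) + blocks (map (markedAt σ (suc (rank σ x))) r)
occ≤blocks-before+after σ x {r} linked = begin
  occ x r
    ≡⟨ occ≡freshCount μ μ-fresh⇔ r ⟩
  freshCount (map μ r)
    ≤⟨ freshCount≤blocks (Linked.map⁺ (Linked.map notBothFresh linked)) ⟩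
  blocks (map wasMarked (map μ r)) + blocks (map isMarked (map μ r))
    ≡⟨ cong₂ (λ u v → blocks u + blocks v) (stage {i = j} (λ t → wasMarked-markOf t j))
                                           (stage {i = suc j} (λ t → isMarked-markOf t j)) ⟩
  blocks (map (markedAt σ j) r) + blocks (map (markedAt σ (suc j)) r) ∎
  where
  open ≤-Reasoning
  open Equivalence
  j = rank σ x
  μ : Fin _ → Mark
  μ y = markOf (rank σ y) j
  μ-fresh⇔ : ∀ y → μ y ≡ fresh ⇔ y ≡ x
  μ-fresh⇔ y = mk⇔ (rank-injective σ ∘ to (markOf-fresh⇔ _ j)) λ { refl → from (markOf-fresh⇔ j j) refl }
  notBothFresh : ∀ {y z} → y ≢ z → NotBothFresh (μ y) (μ z)
  notBothFresh y≢z μy μz = y≢z (trans (to (μ-fresh⇔ _) μy) (sym (to (μ-fresh⇔ _) μz)))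
  stage : ∀ {f : Mark → Bool} {i} → (∀ t → f (markOf t j) ≡ (t <ᵇ i)) →
          map f (map μ r) ≡ map (markedAt σ i) r
  stage f∘markOf = trans (sym (map-∘ r)) (map-cong (λ y → f∘markOf (rank σ y)) r)

LocalWith : ℕ → Permutation′ n → Word n → Set
LocalWith {n} k σ w = ∀ (i : ℕ) → 1 ≤ i → i ≤ n → blocks (map (markedAt σ i) w) ≤ k

module _ {k} {σ : Permutation′ n} {w : Word n} (local : LocalWith k σ w) where

  blocks-markedAt≤ : ∀ i → i ≤ n → blocks (map (markedAt σ i) w) ≤ k
  blocks-markedAt≤ zero    _   = ≤-trans (≤-reflexive (blocksFrom-allFalse false w)) z≤n
  blocks-markedAt≤ (suc i) i<n = local (suc i) (s≤s z≤n) i<n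

  occ≤2k : ∀ {r} → r ⊆ w → Linked _≢_ r → ∀ x → occ x r ≤ k + k
  occ≤2k {r} r⊆w linked x = begin
    occ x r
      ≤⟨ occ≤blocks-before+after σ x linked ⟩
    blocks (map (markedAt σ j) r) + blocks (map (markedAt σ (suc j)) r)
      ≤⟨ +-mono-≤ (bound j (<⇒≤ j<n)) (bound (suc j) j<n) ⟩
    k + k
      ∎
    where
    open ≤-Reasoning
    j = rank σ x
    j<n = toℕ<n (σ ⟨$⟩ˡ x)
    bound : ∀ i → i ≤ n → blocks (map (markedAt σ i) r) ≤ k
    bound i i≤n = ≤-trans (blocksFrom-⊆ (Sublist.map⁺ (markedAt σ i) r⊆w) false) (blocks-markedAt≤ i i≤n)

  alternate⇒occ≤2k : ∀ {a b} → a ≢ b → Alternate w a b → occ a w ≤ k + k × occ b w ≤ k + k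
  alternate⇒occ≤2k {a} {b} a≢b (_ , alt) = bound (inj₁ refl) , bound (inj₂ refl)
    where
    P? = λ x → (x ≟ a) ⊎-dec (x ≟ b)
    bound : ∀ {x} → x ≡ a ⊎ x ≡ b → occ x w ≤ k + k
    bound {x} x∈ab = subst (_≤ k + k) (occ-filter-accept P? x∈ab w)
                           (occ≤2k (Sublist.filter-⊆ P? w) (alternatingWord⇒linked a≢b alt) x)

ShortlyRepresentable : ℕ → GraphClass → Set
ShortlyRepresentable c X = ∀ n G → X n G → ∃[ w ] (length w ≤ n * c × RepresentsEdges w G)

R-shortlyRepresentable : ∀ k → ShortlyRepresentable k (R k)
R-shortlyRepresentable k n G (w , uniform , _ , rep) = w , length≤ w (≤-reflexive ∘ uniform) , rep

L-shortlyRepresentable : ∀ k → ShortlyRepresentable (k + k) (L k)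
L-shortlyRepresentable k n G (w , (σ , local) , _ , rep) = v , length≤ v occ-v≤2k , rep-v
  where
  open Equivalence
  Few : Fin n → Set
  Few y = occ y w ≤ k + k
  few? : Decidable Few
  few? y = occ y w ≤? k + k
  v = filter few? w
  occ-v≤2k : ∀ x → occ x v ≤ k + k
  occ-v≤2k x with few? x
  ... | yes few = ≤-trans (≤-reflexive (occ-filter-accept few? few w)) few
  ... | no many = ≤-trans (≤-reflexive (occ-filter-reject few? many w)) z≤n
  restrict-v : ∀ {a b} → Few a × Few b → restrict a b v ≡ restrict a b w
  restrict-v (a-few , b-few) = restrict-filter few? a-few b-few w
  few-in-v : ∀ {a b} → Alternate v a b → Few a × Few b
  few-in-v {a} {b} alt = let a∈v , b∈v = alternate⇒∈ {w = v} {a} {b} alt in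
    proj₂ (∈-filter⁻ few? {xs = w} a∈v) , proj₂ (∈-filter⁻ few? {xs = w} b∈v)
  rep-v : RepresentsEdges v G
  rep-v a b a≢b = mk⇔
    (λ alt → to (rep a b a≢b) (alternate-transport {w = v} {w} (restrict-v (few-in-v alt)) alt))
    (λ e → let alt = from (rep a b a≢b) e
               few = alternate⇒occ≤2k {σ = σ} {w} local a≢b alt in
           alternate-transport {w = w} {v} (sym (restrict-v few)) alt)

-- Polynomial against exponential growth

[1+x]^[1+s]≤x^[1+s]+[1+s]*[1+x]^s : ∀ x s → suc x ^ suc s ≤ x ^ suc s + suc s * suc x ^ s
[1+x]^[1+s]≤x^[1+s]+[1+s]*[1+x]^s x zero    = ≤-reflexive (+-comm 1 (x * 1))
[1+x]^[1+s]≤x^[1+s]+[1+s]*[1+x]^s x (suc s) = begin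
  suc x * suc x ^ suc s
    ≤⟨ *-monoʳ-≤ (suc x) ([1+x]^[1+s]≤x^[1+s]+[1+s]*[1+x]^s x s) ⟩
  suc x * (x ^ suc s + suc s * suc x ^ s)
    ≡⟨ expand x (x ^ suc s) (suc x ^ s) s ⟩
  x * x ^ suc s + (x ^ suc s + suc s * suc x ^ suc s)
    ≤⟨ +-monoʳ-≤ (x * x ^ suc s) (+-monoˡ-≤ _ (^-monoˡ-≤ (suc s) (n≤1+n x))) ⟩
  x * x ^ suc s + (suc x ^ suc s + suc s * suc x ^ suc s)
    ∎
  where
  open ≤-Reasoning
  expand : ∀ x X Y s → suc x * (X + suc s * Y) ≡ x * X + (X + suc s * (suc x * Y))
  expand = solve-∀

^≤*2^ : ∀ s → ∃[ K ] ∀ x → x ^ s ≤ K * 2 ^ x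
^≤*2^ zero    = 1 , λ x → subst (1 ≤_) (sym (*-identityˡ (2 ^ x))) (m^n>0 2 x)
^≤*2^ (suc s) = 2 * suc s * K , bound′
  where
  K = proj₁ (^≤*2^ s)
  bound = proj₂ (^≤*2^ s)
  bound′ : ∀ x → x ^ suc s ≤ 2 * suc s * K * 2 ^ x
  bound′ zero    = z≤n
  bound′ (suc x) = begin
    suc x ^ suc s
      ≤⟨ [1+x]^[1+s]≤x^[1+s]+[1+s]*[1+x]^s x s ⟩
    x ^ suc s + suc s * suc x ^ s
      ≤⟨ +-mono-≤ (bound′ x) (*-monoʳ-≤ (suc s) (bound (suc x))) ⟩
    2 * suc s * K * 2 ^ x + suc s * (K * (2 * 2 ^ x))
      ≡⟨ collect (suc s) K (2 ^ x) ⟩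
    2 * suc s * K * (2 * 2 ^ x)
      ∎
    where
    open ≤-Reasoning
    collect : ∀ t K p → 2 * t * K * p + t * (K * (2 * p)) ≡ 2 * t * K * (2 * p)
    collect = solve-∀

[2+n]^e≤2^n : ∀ e → ∃[ N ] ∀ n → N ≤ n → (2 + n) ^ e ≤ 2 ^ n
[2+n]^e≤2^n e = 4 * K , λ n 4K≤n → *-cancelˡ-≤ (2 + n) (begin
  (2 + n) ^ suc e        ≤⟨ bound (2 + n) ⟩
  K * 2 ^ (2 + n)        ≡⟨ regroup K (2 ^ n) ⟩
  4 * K * 2 ^ n          ≤⟨ *-monoˡ-≤ (2 ^ n) (≤-trans 4K≤n (m≤n+m n 2)) ⟩
  (2 + n) * 2 ^ n        ∎)
  where
  open ≤-Reasoning
  K = proj₁ (^≤*2^ (suc e))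
  bound = proj₂ (^≤*2^ (suc e))
  regroup : ∀ K p → K * (2 * (2 * p)) ≡ 4 * K * p
  regroup = solve-∀

^-cancelʳ-≤ : ∀ {m o} n .{{_ : NonZero n}} → m ^ n ≤ o ^ n → m ≤ o
^-cancelʳ-≤ {m} {o} n mⁿ≤oⁿ with m ≤? o
... | yes m≤o = m≤o
... | no  m≰o = contradiction mⁿ≤oⁿ (<⇒≱ (^-monoˡ-< n (≰⇒> m≰o)))

[1+n]C2*2≡n*[1+n] : ∀ n → (suc n C 2) * 2 ≡ n * suc n
[1+n]C2*2≡n*[1+n] zero    = refl
[1+n]C2*2≡n*[1+n] (suc n) = begin
  (suc (suc n) C 2) * 2        ≡⟨ cong (_* 2) (sym (nCk+nC[k+1]≡[n+1]C[k+1] (suc n) 1)) ⟩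
  (suc n C 1 + suc n C 2) * 2  ≡⟨ cong (λ c → (c + suc n C 2) * 2) (nC1≡n (suc n)) ⟩
  (suc n + suc n C 2) * 2      ≡⟨ *-distribʳ-+ 2 (suc n) (suc n C 2) ⟩
  suc n * 2 + (suc n C 2) * 2  ≡⟨ cong (suc n * 2 +_) ([1+n]C2*2≡n*[1+n] n) ⟩
  suc n * 2 + n * suc n        ≡⟨ factor n ⟩
  suc n * suc (suc n)          ∎
  where
  open ≡-Reasoning
  factor : ∀ n → suc n * 2 + n * suc n ≡ suc n * suc (suc n)
  factor = solve-∀

-- Squaring avoids halving n: ((n+1)^{nc})^{2m} = ((n+1)^{2cm})^n ≤ (2^{n-1})^n = (2^{C(n,2)})².
[1+n]^[nc]^m≤2^[nC2] : ∀ c m → ∃[ N ] ∀ n → N ≤ n → (suc n ^ (n * c)) ^ m ≤ 2 ^ (n C 2)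
[1+n]^[nc]^m≤2^[nC2] c m = suc N , bound′
  where
  e = c * m * 2
  N = proj₁ ([2+n]^e≤2^n e)
  bound = proj₂ ([2+n]^e≤2^n e)
  bound′ : ∀ n → suc N ≤ n → (suc n ^ (n * c)) ^ m ≤ 2 ^ (n C 2)
  bound′ (suc n) (s≤s N≤n) = ^-cancelʳ-≤ 2 (begin
    ((y ^ (suc n * c)) ^ m) ^ 2    ≡⟨ cong (_^ 2) (^-*-assoc y (suc n * c) m) ⟩
    (y ^ (suc n * c * m)) ^ 2      ≡⟨ ^-*-assoc y (suc n * c * m) 2 ⟩
    y ^ (suc n * c * m * 2)        ≡⟨ cong (y ^_) (reorder (suc n) c m) ⟩
    y ^ (e * suc n)                ≡⟨ sym (^-*-assoc y e (suc n)) ⟩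
    (y ^ e) ^ suc n                ≤⟨ ^-monoˡ-≤ (suc n) (bound n N≤n) ⟩
    (2 ^ n) ^ suc n                ≡⟨ ^-*-assoc 2 n (suc n) ⟩
    2 ^ (n * suc n)                ≡⟨ cong (2 ^_) (sym ([1+n]C2*2≡n*[1+n] n)) ⟩
    2 ^ ((suc n C 2) * 2)          ≡⟨ sym (^-*-assoc 2 (suc n C 2) 2) ⟩
    (2 ^ (suc n C 2)) ^ 2          ∎)
    where
    open ≤-Reasoning
    y = 2 + n
    reorder : ∀ n c m → n * c * m * 2 ≡ c * m * 2 * n
    reorder = solve-∀

restrict-allFin : ∀ {a b : Fin n} → a ≢ b →
  restrict a b (allFin n) ≡ a ∷ b ∷ [] ⊎ restrict a b (allFin n) ≡ b ∷ a ∷ []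
restrict-allFin {n} {a} {b} a≢b =
  unique-pair a≢b (Unique.filter⁺ P? (Unique.allFin⁺ n)) (all-filter P? (allFin n))
                  (∈-filter⁺ P? (∈-allFin a) (inj₁ refl)) (∈-filter⁺ P? (∈-allFin b) (inj₂ refl))
  where P? = λ x → (x ≟ a) ⊎-dec (x ≟ b)

occ-allFin : ∀ (x : Fin n) → occ x (allFin n) ≡ 1
occ-allFin {n} x = cong length (unique-singleton (Unique.filter⁺ (_≟ x) (Unique.allFin⁺ n))
  (all-filter (_≟ x) (allFin n)) (∈-filter⁺ (_≟ x) (∈-allFin x) refl))

complete : ∀ n → Graph n
complete n = record
  { adj    = λ x y → not (does (x ≟ y))
  ; irrefl = λ x → cong not (dec-true (x ≟ x) refl)
  ; sym    = λ x y → cong not (does-⇔ (mk⇔ sym sym) (x ≟ y) (y ≟ x))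
  }

complete-represented : ∀ m → Represents (rep (suc m) (allFin n)) (complete n)
complete-represented {n} m = (λ x → ∈-++⁺ˡ (∈-allFin x)) ,
  λ a b a≢b → mk⇔ (λ _ → cong not (dec-false (a ≟ b) a≢b)) (λ _ → alternate a≢b)
  where
  restrict-rep : ∀ {a b u} → restrict a b (allFin n) ≡ u → restrict a b (rep (suc m) (allFin n)) ≡ rep (suc m) u
  restrict-rep = trans (filter-rep _ (suc m) (allFin n)) ∘ cong (rep (suc m))
  alternate : ∀ {a b} → a ≢ b → Alternate (rep (suc m) (allFin n)) a b
  alternate {a} {b} a≢b with restrict-allFin a≢b
  ... | inj₁ ab = suc m , s≤s z≤n , inj₁ (restrict-rep ab)
  ... | inj₂ ba = suc m , s≤s z≤n , inj₂ (inj₂ (inj₁ (restrict-rep ba)))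

blocksFrom-true-prefix : ∀ n i → blocksFrom true (tabulate {n = n} (λ x → toℕ x <ᵇ i)) ≡ 0
blocksFrom-true-prefix zero    i       = refl
blocksFrom-true-prefix (suc n) zero    = trans (cong (blocksFrom false) (sym (map-tabulate {n = n} id (λ _ → false))))
                                               (blocksFrom-allFalse false (allFin n))
blocksFrom-true-prefix (suc n) (suc i) = blocksFrom-true-prefix n i

blocks-prefix≤1 : ∀ n i → blocks (tabulate {n = n} (λ x → toℕ x <ᵇ i)) ≤ 1
blocks-prefix≤1 zero    i       = z≤n
blocks-prefix≤1 (suc n) zero    = blocks-prefix≤1 n zero
blocks-prefix≤1 (suc n) (suc i) = s≤s (≤-reflexive (blocksFrom-true-prefix n i))

R-inhabited : ∀ k n → ∃[ G ] R (suc k) n G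
R-inhabited k n = complete n , rep (suc k) (allFin n) , uniform , complete-represented k
  where
  uniform : Uniform (suc k) (rep (suc k) (allFin n))
  uniform x = trans (occ-rep x (suc k) (allFin n))
                    (trans (cong (suc k *_) (occ-allFin x)) (*-identityʳ (suc k)))

L-inhabited : ∀ {k} → 1 ≤ k → ∀ n → ∃[ G ] L k n G
L-inhabited {k} 1≤k n = complete n , rep 1 (allFin n) , (Perm.id , local) , complete-represented 0
  where
  local : LocalWith k Perm.id (rep 1 (allFin n))
  local i _ _ = begin
    blocks (map (markedAt Perm.id i) (allFin n ++ []))
      ≡⟨ cong (blocks ∘ map (markedAt Perm.id i)) (++-identityʳ (allFin n)) ⟩
    blocks (map (markedAt Perm.id i) (allFin n))
      ≡⟨ cong blocks (map-tabulate {n = n} id (markedAt Perm.id i)) ⟩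
    blocks (tabulate {n = n} (λ x → toℕ x <ᵇ i))
      ≤⟨ blocks-prefix≤1 n i ⟩
    1
      ≤⟨ 1≤k ⟩
    k ∎
    where open ≤-Reasoning

entropyZero : ∀ (X : GraphClass) c → (∀ n → ∃[ G ] X n G) → ShortlyRepresentable c X → EntropyZero X
entropyZero X c inhabited short m _ =
  let N , bound = [1+n]^[nc]^m≤2^[nC2] c m in
  N , λ n N≤n → inhabited n , suc n ^ (n * c) , bound n N≤n , cardLe-shortWords (n * c) (short n)

mainTheorem4 : (∀ (k : ℕ) → EntropyZero (R (suc k))) ×
               (∀ (k : ℕ) → 1 ≤ k → EntropyZero (L k))
mainTheorem4 =
  (λ k → entropyZero (R (suc k)) (suc k) (R-inhabited k) (R-shortlyRepresentable (suc k))) ,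
  (λ k 1≤k → entropyZero (L k) (k + k) (L-inhabited 1≤k) (L-shortlyRepresentable k))
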